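{- Let $s,k$ be jobs and let $S$ be an $(s,k)$-schedule with $C_{\max}(S)=t$. Suppose that $[u,t)$ is a fixed segment of $S$. Then for every job $i\le k$ with $u<C_i(S)\le t$ we have $C_i(S)=C^*_{s,i}$.
   Context: Time is discrete, divided into unit slots $[t,t+1)$ (slot $t$), $t\in\mathbb{Z}$. There are $n$ jobs $1,\dots,n$; job $j$ has integer release time $r_j$, deadline $d_j$ and positive integer processing time $p_j$. A (partial, preemptive) schedule $S$ assigns to each slot at most one job, and each job it schedules receives exactly $p_j$ slots, all within $[r_j,d_j)$. $C_j(S)$ is the end of the last slot of $j$, $C_{\max}(S)=\max_jC_j(S)$. Standing assumptions: $d_1<\dots<d_n$, release times pairwise distinct, the instance is feasible. All schedules have the earliest-deadline property: at every slot $t$, $S$ is either idle or executes, among the jobs scheduled by $S$ that are released at or before $t$ and not yet completed, the one with smallest deadline. An $(s,k)$-schedule is a partial schedule $S$ with $C_{\max}(S)\le d_k$ whose set of scheduled jobs is exactly $\{j\le k: r_s\le r_j<C_{\max}(S)\}$ (the empty schedule counts, with completion time $r_s$). For $i$ with $r_i\ge r_s$, $C^*_{s,i}$ denotes the minimum completion time of $i$ among all $(s,k)$-schedules scheduling $i$, for any $k\ge i$ (this value does not depend on $k$). An interval $[t',t)$ is a fixed segment of $S$ if $S$ is busy in all slots of $[t',t)$ and every job executed in $[t',t)$ is released in $[t',t)$ and completed by $S$ within $[t',t)$. -}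

module Defs where

open import Data.Nat as ℕ using (ℕ; zero; suc)
open import Data.Integer as ℤ using (ℤ; _+_; _-_; _≤_; _<_; +_; 1ℤ)
open import Data.Fin as Fin using (Fin)
open import Data.Maybe using (Maybe; just; nothing)
open import Data.Product using (Σ; ∃; _×_; _,_)
open import Data.Sum using (_⊎_)
open import Relation.Binary.PropositionalEquality using (_≡_; _≢_)
open import Relation.Nullary using (¬_; yes; no)

-- A (partial) schedule: slot t = [t, t+1) is idle (nothing) or runs a job.
Schedule : ℕ → Set
Schedule n = ℤ → Maybe (Fin n)

hit : {n : ℕ} → Maybe (Fin n) → Fin n → ℕ
hit nothing  j = 0
hit (just x) j with x Fin.≟ j
... | yes _ = 1
... | no  _ = 0

countFrom : {n : ℕ} → Schedule n → Fin n → ℤ → ℕ → ℕ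
countFrom S j a zero    = 0
countFrom S j a (suc l) = hit (S a) j ℕ.+ countFrom S j (a + 1ℤ) l

module _ {n : ℕ} (r d : Fin n → ℤ) (p : Fin n → ℕ) where

  Scheduled : Schedule n → Fin n → Set
  Scheduled S j = ∃ λ t → S t ≡ just j

  Completion : Schedule n → Fin n → ℤ → Set
  Completion S j c = (S (c - 1ℤ) ≡ just j) × (∀ t → c ≤ t → S t ≢ just j)

  NotCompletedAt : Schedule n → Fin n → ℤ → Set
  NotCompletedAt S j t = ∃ λ t' → (t ≤ t') × (S t' ≡ just j)

  ValidPartial : Schedule n → Set
  ValidPartial S =
    (∀ t j → S t ≡ just j → (r j ≤ t) × (t < d j)) ×
    (∀ j → Scheduled S j → countFrom S j (r j) (ℤ.∣ d j - r j ∣) ≡ p j)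

  EDF : Schedule n → Set
  EDF S = ∀ t j → S t ≡ just j →
          ∀ j' → Scheduled S j' → r j' ≤ t → NotCompletedAt S j' t → d j ≤ d j'

  IsSchedule : Schedule n → Set
  IsSchedule S = ValidPartial S × EDF S

  -- C_max(S) = m, with the convention that the empty schedule has C_max = base
  Cmax : ℤ → Schedule n → ℤ → Set
  Cmax base S m =
    (∀ j c → Completion S j c → c ≤ m) ×
    ((∃ λ j → Completion S j m) ⊎ ((∀ j → ¬ Scheduled S j) × (m ≡ base)))

  SKSchedule : Fin n → Fin n → Schedule n → ℤ → Set
  SKSchedule s k S m =
    IsSchedule S × Cmax (r s) S m × (m ≤ d k) ×
    (∀ j → Scheduled S j → (j Fin.≤ k) × (r s ≤ r j) × (r j < m)) ×
    (∀ j → j Fin.≤ k → r s ≤ r j → r j < m → Scheduled S j)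

  OptCompletion : Fin n → Fin n → ℤ → Set
  OptCompletion s i c =
    (∃ λ k → (i Fin.≤ k) × ∃ λ S → ∃ λ m → SKSchedule s k S m × Completion S i c) ×
    (∀ k → i Fin.≤ k → ∀ S m → SKSchedule s k S m → ∀ c' → Completion S i c' → c ≤ c')

  FixedSegment : Schedule n → ℤ → ℤ → Set
  FixedSegment S u t =
    (∀ x → u ≤ x → x < t → S x ≢ nothing) ×
    (∀ x j → u ≤ x → x < t → S x ≡ just j →
       (u ≤ r j) × (r j < t) × (∀ c → Completion S j c → c ≤ t))

  Feasible : Set
  Feasible = ∃ λ S → IsSchedule S × (∀ j → Scheduled S j)

  StandingAssumptions : Set
  StandingAssumptions =
    (∀ j → 0 ℕ.< p j) ×
    (∀ i j → i Fin.< j → d i < d j) ×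
    (∀ i j → r i ≡ r j → i ≡ j) ×
    Feasible

-- Suppose some (s,k′)-schedule S′ completes i at c′ < c. Go back from c to the
-- smallest v ≥ u such that S runs only jobs j ≤ i in [v, c). Every job run in [v, c)
-- is released at or after v: if v = u by the fixed segment, otherwise because S runs
-- a job h > i at v - 1, which EDF does not do while a job of smaller deadline is pending.
-- Now consider the jobs j ≤ i with v ≤ r j < c′. EDF completes each of them before i,
-- so S processes them inside [v, c) and S′ inside [v, c′); their total processing time
-- is therefore at most c′ - v. But in S they fill every slot of [v, c′) and also the
-- last slot c - 1 of i.

module Submission where

open import Defs
open import Data.Nat as ℕ using (ℕ; zero; suc)
import Data.Nat.Properties as ℕP
open import Data.Integer as ℤ using (ℤ; _+_; _-_; _≤_; _<_; +_; 1ℤ; ∣_∣; _⊓_; _⊔_)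
import Data.Integer.Properties as ℤP
open import Data.Integer.Tactic.RingSolver using (solve-∀)
open import Data.Fin as Fin using (Fin)
import Data.Fin.Properties as FP
open import Data.Maybe using (Maybe; just; nothing)
open import Data.Maybe.Properties using (just-injective)
open import Data.Bool using (if_then_else_)
open import Data.Product using (∃; _×_; _,_; proj₁; proj₂)
open import Data.Sum using (_⊎_; inj₁; inj₂)
open import Data.Empty using (⊥; ⊥-elim)
open import Function using (_∘_)
open import Relation.Nullary using (¬_; yes; no; does)
open import Relation.Nullary.Decidable using (_×-dec_)
open import Relation.Unary using (Decidable)
open import Relation.Binary.PropositionalEquality
open import Relation.Binary.Definitions using (tri<; tri≈; tri>)
open import Algebra.Properties.CommutativeMonoid.Sum ℕP.+-0-commutativeMonoid
  using (sum; sum-cong-≗; sum-remove; sum-replicate-zero; ∑-distrib-+)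

private
  <⇒+1≤ : ∀ {x y} → x < y → x + 1ℤ ≤ y
  <⇒+1≤ {x} {y} x<y = subst (_≤ y) (ℤP.+-comm 1ℤ x) (ℤP.i<j⇒suc[i]≤j x<y)

  +1≤⇒< : ∀ {x y} → x + 1ℤ ≤ y → x < y
  +1≤⇒< {x} {y} x+1≤y = ℤP.suc[i]≤j⇒i<j (subst (_≤ y) (ℤP.+-comm x 1ℤ) x+1≤y)

  <⇒≤-1 : ∀ {x y} → x < y → x ≤ y - 1ℤ
  <⇒≤-1 {x} {y} x<y = subst (x ≤_) (ℤP.+-comm ℤ.-1ℤ y) (ℤP.i<j⇒i≤pred[j] x<y)

  ≤-1⇒< : ∀ {x y} → x ≤ y - 1ℤ → x < y
  ≤-1⇒< {x} {y} x≤y-1 = ℤP.i≤pred[j]⇒i<j (subst (x ≤_) (ℤP.+-comm y ℤ.-1ℤ) x≤y-1)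

  i-1<i : ∀ x → x - 1ℤ < x
  i-1<i x = ≤-1⇒< ℤP.≤-refl

  +1-+-suc : ∀ a L → a + 1ℤ + + L ≡ a + + suc L
  +1-+-suc a L = trans (ℤP.+-assoc a 1ℤ (+ L)) (cong (_+_ a) (sym (ℤP.pos-+ 1 L)))

  +-suc-1 : ∀ a L → a + + suc L - 1ℤ ≡ a + + L
  +-suc-1 a L = trans (cong (_- 1ℤ) (sym (+1-+-suc a L))) (cancel a (+ L))
    where cancel : ∀ a k → a + 1ℤ + k - 1ℤ ≡ a + k
          cancel = solve-∀

  i<i+suc : ∀ a L → a < a + + suc L
  i<i+suc a L = +1≤⇒< (subst (a + 1ℤ ≤_) (+1-+-suc a L) (ℤP.i≤i+j (a + 1ℤ) (+ L)))

  i+∣j-i∣≡j : ∀ {a b} → a ≤ b → a + + ∣ b - a ∣ ≡ b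
  i+∣j-i∣≡j {a} {b} a≤b =
    trans (cong (_+_ a) (ℤP.0≤i⇒+∣i∣≡i (ℤP.i≤j⇒0≤j-i a≤b))) (cancel a b)
    where cancel : ∀ a b → a + (b - a) ≡ b
          cancel = solve-∀

  +-cancelˡ-≤⁺ : ∀ a L M → a + + L ≤ a + + M → L ℕ.≤ M
  +-cancelˡ-≤⁺ a L M le =
    ℤP.drop‿+≤+ (subst₂ _≤_ (cancel a (+ L)) (cancel a (+ M)) (ℤP.+-monoʳ-≤ (ℤ.- a) le))
    where cancel : ∀ a k → ℤ.- a + (a + k) ≡ k
          cancel = solve-∀

  +-cancelˡ-<⁺ : ∀ a L M → a + + L < a + + M → L ℕ.< M
  +-cancelˡ-<⁺ a L M lt =
    +-cancelˡ-≤⁺ a (suc L) M (subst (_≤ a + + M) (trans (swap a (+ L)) (+1-+-suc a L)) (<⇒+1≤ lt))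
    where swap : ∀ a k → a + k + 1ℤ ≡ a + 1ℤ + k
          swap = solve-∀

hit-≢ : ∀ {n} (m : Maybe (Fin n)) {j} → m ≢ just j → hit m j ≡ 0
hit-≢ nothing  _  = refl
hit-≢ (just y) {j} m≢ with y Fin.≟ j
... | yes refl = ⊥-elim (m≢ refl)
... | no  _    = refl

hit-just : ∀ {n} (j : Fin n) → hit (just j) j ≡ 1
hit-just j with j Fin.≟ j
... | yes _   = refl
... | no  j≢j = ⊥-elim (j≢j refl)

module _ {n : ℕ} (S : Schedule n) (j : Fin n) where

  SlotsWithin : ℤ → ℕ → Set
  SlotsWithin a L = ∀ x → S x ≡ just j → (a ≤ x) × (x < a + + L)

  countFrom-absent : ∀ a L → (∀ x → a ≤ x → x < a + + L → S x ≢ just j) →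
                     countFrom S j a L ≡ 0
  countFrom-absent a zero    _      = refl
  countFrom-absent a (suc L) absent =
    cong₂ ℕ._+_ (hit-≢ (S a) (absent a ℤP.≤-refl (i<i+suc a L)))
                (countFrom-absent (a + 1ℤ) L λ x a+1≤x x< →
                  absent x (ℤP.<⇒≤ (+1≤⇒< a+1≤x)) (subst (x <_) (+1-+-suc a L) x<))

  countFrom-extendʳ : ∀ a L M → L ℕ.≤ M →
                      (∀ x → a + + L ≤ x → x < a + + M → S x ≢ just j) →
                      countFrom S j a M ≡ countFrom S j a L
  countFrom-extendʳ a zero    M       _           absent =
    countFrom-absent a M λ x a≤x → absent x (subst (_≤ x) (sym (ℤP.+-identityʳ a)) a≤x)
  countFrom-extendʳ a (suc L) (suc M) (ℕ.s≤s L≤M) absent =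
    cong (hit (S a) j ℕ.+_) (countFrom-extendʳ (a + 1ℤ) L M L≤M λ x ≤x x< →
      absent x (subst (_≤ x) (+1-+-suc a L) ≤x) (subst (x <_) (+1-+-suc a M) x<))

  countFrom-superwindow : ∀ a₀ M a L → a₀ ≤ a → a + + L ≤ a₀ + + M → SlotsWithin a L →
                          countFrom S j a₀ M ≡ countFrom S j a L
  countFrom-superwindow a₀ M a L a₀≤a end≤ within with ℤP.<-cmp a₀ a
  ... | tri≈ _ refl _ = countFrom-extendʳ a L M (+-cancelˡ-≤⁺ a L M end≤) λ x ≤x x< eq →
                          ℤP.<-irrefl refl (ℤP.<-≤-trans (proj₂ (within x eq)) ≤x)
  ... | tri> _ _ a<a₀ = ⊥-elim (ℤP.<-irrefl refl (ℤP.<-≤-trans a<a₀ a₀≤a))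
  ... | tri< a₀<a _ _ with M
  ...   | zero   = ⊥-elim (ℤP.<-irrefl refl (ℤP.<-≤-trans a₀<a (ℤP.≤-trans
                     (ℤP.i≤i+j a (+ L)) (subst (a + + L ≤_) (ℤP.+-identityʳ a₀) end≤))))
  ...   | suc M′ =
    cong₂ ℕ._+_ (hit-≢ (S a₀) λ eq → ℤP.<-irrefl refl (ℤP.<-≤-trans a₀<a (proj₁ (within a₀ eq))))
                (countFrom-superwindow (a₀ + 1ℤ) M′ a L (<⇒+1≤ a₀<a)
                   (subst (a + + L ≤_) (sym (+1-+-suc a₀ M′)) end≤) within)

  countFrom-window-irrelevant : ∀ a L a′ L′ → SlotsWithin a L → SlotsWithin a′ L′ →
                                countFrom S j a L ≡ countFrom S j a′ L′
  countFrom-window-irrelevant a L a′ L′ within within′ =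
    trans (sym (countFrom-superwindow a₀ M a L (ℤP.i⊓j≤i a a′) (ℤP.≤-trans (ℤP.i≤i⊔j _ _) end≡) within))
          (countFrom-superwindow a₀ M a′ L′ (ℤP.i⊓j≤j a a′) (ℤP.≤-trans (ℤP.i≤j⊔i _ _) end≡) within′)
    where
      a₀ b₀ : ℤ
      a₀ = a ⊓ a′
      b₀ = (a + + L) ⊔ (a′ + + L′)
      M : ℕ
      M = ∣ b₀ - a₀ ∣
      end≡ : b₀ ≤ a₀ + + M
      end≡ = ℤP.≤-reflexive (sym (i+∣j-i∣≡j
               (ℤP.≤-trans (ℤP.i⊓j≤i a a′) (ℤP.≤-trans (ℤP.i≤i+j a (+ L)) (ℤP.i≤i⊔j _ _)))))

occupied : ∀ {A : Set} → Maybe A → ℕ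
occupied nothing  = 0
occupied (just _) = 1

busyFrom : ∀ {n} → Schedule n → ℤ → ℕ → ℕ
busyFrom S a zero    = 0
busyFrom S a (suc L) = occupied (S a) ℕ.+ busyFrom S (a + 1ℤ) L

∑-hit≡occupied : ∀ {n} (m : Maybe (Fin n)) → sum (hit m) ≡ occupied m
∑-hit≡occupied {n}     nothing  = sum-replicate-zero n
∑-hit≡occupied {suc n} (just y) = begin
  sum (hit (just y))                                   ≡⟨ sum-remove (hit (just y)) ⟩
  hit (just y) y ℕ.+ sum (λ k → hit (just y) (Fin.punchIn y k))
    ≡⟨ cong₂ ℕ._+_ (hit-just y) (trans (sum-cong-≗ others) (sum-replicate-zero n)) ⟩
  1 ∎
  where
    open ≡-Reasoning
    others : ∀ k → hit (just y) (Fin.punchIn y k) ≡ 0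
    others k = hit-≢ (just y) (FP.punchInᵢ≢i y k ∘ sym ∘ just-injective)

∑-countFrom≡busyFrom : ∀ {n} (S : Schedule n) a L → sum (λ j → countFrom S j a L) ≡ busyFrom S a L
∑-countFrom≡busyFrom {n} S a zero    = sum-replicate-zero n
∑-countFrom≡busyFrom     S a (suc L) =
  trans (∑-distrib-+ (hit (S a)) (λ j → countFrom S j (a + 1ℤ) L))
        (cong₂ ℕ._+_ (∑-hit≡occupied (S a)) (∑-countFrom≡busyFrom S (a + 1ℤ) L))

module _ {n : ℕ} (S : Schedule n) where

  Busy : ℤ → Set
  Busy x = ∃ λ j → S x ≡ just j

  busyFrom≤length : ∀ a L → busyFrom S a L ℕ.≤ L
  busyFrom≤length a zero    = ℕ.z≤n
  busyFrom≤length a (suc L) = ℕP.+-mono-≤ (occupied≤1 (S a)) (busyFrom≤length (a + 1ℤ) L)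
    where
      occupied≤1 : (m : Maybe (Fin n)) → occupied m ℕ.≤ 1
      occupied≤1 nothing  = ℕ.z≤n
      occupied≤1 (just _) = ℕP.≤-refl

  busyFrom-positive : ∀ a L x → a ≤ x → x < a + + L → Busy x → 1 ℕ.≤ busyFrom S a L
  busyFrom-positive a zero    x a≤x x< _ =
    ⊥-elim (ℤP.<-irrefl refl (ℤP.≤-<-trans a≤x (subst (x <_) (ℤP.+-identityʳ a) x<)))
  busyFrom-positive a (suc L) x a≤x x< (j , Sx≡j) with ℤP.<-cmp a x
  ... | tri≈ _ refl _ rewrite Sx≡j = ℕ.s≤s ℕ.z≤n
  ... | tri> _ _ x<a  = ⊥-elim (ℤP.<-irrefl refl (ℤP.<-≤-trans x<a a≤x))
  ... | tri< a<x _ _  = ℕP.≤-trans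
          (busyFrom-positive (a + 1ℤ) L x (<⇒+1≤ a<x) (subst (x <_) (sym (+1-+-suc a L)) x<) (j , Sx≡j))
          (ℕP.m≤n+m _ (occupied (S a)))

  busyFrom-lowerBound : ∀ a M L → M ℕ.< L → (∀ x → a ≤ x → x < a + + M → Busy x) →
                        ∀ y → a + + M ≤ y → y < a + + L → Busy y → suc M ℕ.≤ busyFrom S a L
  busyFrom-lowerBound a zero L _ _ y ≤y y< busy-y =
    busyFrom-positive a L y (subst (_≤ y) (ℤP.+-identityʳ a) ≤y) y< busy-y
  busyFrom-lowerBound a (suc M) (suc L) (ℕ.s≤s M<L) busy y ≤y y< busy-y
    with busy a ℤP.≤-refl (i<i+suc a M)
  ... | (j , Sa≡j) rewrite Sa≡j =
    ℕ.s≤s (busyFrom-lowerBound (a + 1ℤ) M L M<L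
      (λ x ≤x x< → busy x (ℤP.<⇒≤ (+1≤⇒< ≤x)) (subst (x <_) (+1-+-suc a M) x<))
      y (subst (_≤ y) (sym (+1-+-suc a M)) ≤y) (subst (y <_) (sym (+1-+-suc a L)) y<) busy-y)

module _ {n : ℕ} {P : Fin n → Set} (P? : Decidable P) where

  keep : Maybe (Fin n) → Maybe (Fin n)
  keep nothing  = nothing
  keep (just j) = if does (P? j) then just j else nothing

  restrict : Schedule n → Schedule n
  restrict S = keep ∘ S

  keep-just : ∀ {j} → P j → keep (just j) ≡ just j
  keep-just {j} Pj with P? j
  ... | yes _   = refl
  ... | no  ¬Pj = ⊥-elim (¬Pj Pj)

  keep≡just⇒P : ∀ m {j} → keep m ≡ just j → P j
  keep≡just⇒P (just y) eq with P? y
  keep≡just⇒P (just y) eq | yes Py = subst P (just-injective eq) Py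
  keep≡just⇒P (just y) () | no  _

  hit-keep : ∀ m {j} → P j → hit (keep m) j ≡ hit m j
  hit-keep nothing  _ = refl
  hit-keep (just y) Pj with P? y
  ... | yes _   = refl
  ... | no  ¬Py = sym (hit-≢ (just y) λ eq → ¬Py (subst P (sym (just-injective eq)) Pj))

  restrict-just : ∀ S {x j} → P j → S x ≡ just j → restrict S x ≡ just j
  restrict-just S Pj Sx≡j = trans (cong keep Sx≡j) (keep-just Pj)

  countFrom-restrict : ∀ S {j} → P j → ∀ a L → countFrom (restrict S) j a L ≡ countFrom S j a L
  countFrom-restrict S Pj a zero    = refl
  countFrom-restrict S Pj a (suc L) =
    cong₂ ℕ._+_ (hit-keep (S a) Pj) (countFrom-restrict S Pj (a + 1ℤ) L)

  countFrom-restrict-¬ : ∀ S {j} → ¬ P j → ∀ a L → countFrom (restrict S) j a L ≡ 0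
  countFrom-restrict-¬ S {j} ¬Pj a L =
    countFrom-absent (restrict S) j a L λ x _ _ eq → ¬Pj (keep≡just⇒P (S x) eq)

record MaximalSuffix (Q : ℤ → Set) (u w : ℤ) : Set where
  field
    start   : ℤ
    u≤start : u ≤ start
    start≤w : start ≤ w
    holds   : ∀ x → start ≤ x → x < w → Q x
    maximal : start ≡ u ⊎ (u < start × ¬ Q (start - 1ℤ))

opaque
  maximalSuffix : ∀ {Q : ℤ → Set} → Decidable Q → ∀ {u w} → u ≤ w → MaximalSuffix Q u w
  maximalSuffix {Q} Q? {u} {w} u≤w = subst (MaximalSuffix Q u) (i+∣j-i∣≡j u≤w) (go ∣ w - u ∣)
    where
      go : ∀ K → MaximalSuffix Q u (u + + K)
      go zero = record
        { start = u ; u≤start = ℤP.≤-refl ; start≤w = ℤP.i≤i+j u (+ 0)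
        ; holds = λ x u≤x x< → ⊥-elim (ℤP.<-irrefl refl
                    (ℤP.≤-<-trans u≤x (subst (x <_) (ℤP.+-identityʳ u) x<)))
        ; maximal = inj₁ refl }
      go (suc K) with Q? (u + + K)
      ... | no ¬Q = record
        { start = u + + suc K ; u≤start = ℤP.i≤i+j u (+ suc K) ; start≤w = ℤP.≤-refl
        ; holds = λ x ≤x x< → ⊥-elim (ℤP.<-irrefl refl (ℤP.<-≤-trans x< ≤x))
        ; maximal = inj₂ (i<i+suc u K , ¬Q ∘ subst Q (+-suc-1 u K)) }
      ... | yes Q[u+K] = record
        { start = start ; u≤start = u≤start
        ; start≤w = ℤP.≤-trans start≤w (ℤP.+-monoʳ-≤ u (ℤ.+≤+ (ℕP.n≤1+n K)))
        ; holds = holds′ ; maximal = maximal }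
        where
          open MaximalSuffix (go K)
          holds′ : ∀ x → start ≤ x → x < u + + suc K → Q x
          holds′ x ≤x x< with x ℤ.≟ u + + K
          ... | yes refl = Q[u+K]
          ... | no  x≢   = holds x ≤x (ℤP.≤∧≢⇒< (subst (x ≤_) (+-suc-1 u K) (<⇒≤-1 x<)) x≢)

DeadlinesIncreasing : ∀ {n} → (Fin n → ℤ) → Set
DeadlinesIncreasing d = ∀ i j → i Fin.< j → d i < d j

module _ {n : ℕ} (r d : Fin n → ℤ) (p : Fin n → ℕ) where

  countFrom≡processingTime : ∀ {S j a b} → ValidPartial r d p S → Scheduled r d p S j → a ≤ b →
                             (∀ x → S x ≡ just j → (a ≤ x) × (x < b)) → countFrom S j a ∣ b - a ∣ ≡ p j
  countFrom≡processingTime {S} {j} {a} {b} (inWindow , exact) (x₀ , Sx₀≡j) a≤b slots =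
    trans (countFrom-window-irrelevant S j a _ (r j) _ (asLength a≤b slots)
                                               (asLength rj≤dj λ x → inWindow x j))
          (exact j (x₀ , Sx₀≡j))
    where
      asLength : ∀ {a b} → a ≤ b → (∀ x → S x ≡ just j → (a ≤ x) × (x < b)) →
                 SlotsWithin S j a ∣ b - a ∣
      asLength a≤b slots x eq = proj₁ (slots x eq) , subst (x <_) (sym (i+∣j-i∣≡j a≤b)) (proj₂ (slots x eq))
      rj≤dj : r j ≤ d j
      rj≤dj = ℤP.<⇒≤ (ℤP.≤-<-trans (proj₁ (inWindow x₀ j Sx₀≡j)) (proj₂ (inWindow x₀ j Sx₀≡j)))

  edf-index≤ : DeadlinesIncreasing d → ∀ {S} → EDF r d p S → ∀ {t x h j} →
               S t ≡ just h → S x ≡ just j → t ≤ x → r j ≤ t → h Fin.≤ j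
  edf-index≤ increasing edf St≡h Sx≡j t≤x rj≤t = ℕP.≮⇒≥ λ j<h →
    ℤP.<⇒≱ (increasing _ _ j<h) (edf _ _ St≡h _ (_ , Sx≡j) rj≤t (_ , t≤x , Sx≡j))

  edf-completes-before : DeadlinesIncreasing d → ∀ {S} → EDF r d p S → ∀ {i e} → Completion r d p S i e →
                         ∀ {j x} → j Fin.≤ i → r j < e → S x ≡ just j → x < e
  edf-completes-before increasing {S} edf {i} {e} (Se-1≡i , after) {j} {x} j≤i rj<e Sx≡j with x ℤ.<? e
  ... | yes x<e = x<e
  ... | no  x≮e = ⊥-elim (after x e≤x (subst (λ h → S x ≡ just h) (FP.≤-antisym j≤i i≤j) Sx≡j))
    where
      e≤x : e ≤ x
      e≤x = ℤP.≮⇒≥ x≮e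
      i≤j : i Fin.≤ j
      i≤j = edf-index≤ increasing edf Se-1≡i Sx≡j (ℤP.<⇒≤ (ℤP.<-≤-trans (i-1<i e) e≤x)) (<⇒≤-1 rj<e)

  sk-valid : ∀ {s k S m} → SKSchedule r d p s k S m → ValidPartial r d p S
  sk-valid sk = proj₁ (proj₁ sk)

  sk-edf : ∀ {s k S m} → SKSchedule r d p s k S m → EDF r d p S
  sk-edf sk = proj₂ (proj₁ sk)

  slot-in-window : ∀ {S x j} → ValidPartial r d p S → S x ≡ just j → (r j ≤ x) × (x < d j)
  slot-in-window valid = proj₁ valid _ _

  sk-released : ∀ {s k S m j} → SKSchedule r d p s k S m → Scheduled r d p S j → r s ≤ r j
  sk-released sk sch = proj₁ (proj₂ (proj₁ (proj₂ (proj₂ (proj₂ sk))) _ sch))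

  sk-complete : ∀ {s k S m j} → SKSchedule r d p s k S m →
                j Fin.≤ k → r s ≤ r j → r j < m → Scheduled r d p S j
  sk-complete sk = proj₂ (proj₂ (proj₂ (proj₂ sk))) _

  sk-completion≤Cmax : ∀ {s k S m j e} → SKSchedule r d p s k S m → Completion r d p S j e → e ≤ m
  sk-completion≤Cmax sk = proj₁ (proj₁ (proj₂ sk)) _ _

RunsJobAtMost : ∀ {n} → Fin n → Maybe (Fin n) → Set
RunsJobAtMost i nothing  = ⊥
RunsJobAtMost i (just j) = j Fin.≤ i

runsJobAtMost? : ∀ {n} (i : Fin n) → Decidable (RunsJobAtMost i)
runsJobAtMost? i nothing  = no λ ()
runsJobAtMost? i (just j) = j Fin.≤? i

module Optimality {n : ℕ} {r d : Fin n → ℤ} {p : Fin n → ℕ} (increasing : DeadlinesIncreasing d)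
                  {s k : Fin n} {S : Schedule n} {t u : ℤ}
                  (sk : SKSchedule r d p s k S t) (fs : FixedSegment r d p S u t)
                  {i : Fin n} (i≤k : i Fin.≤ k) {c : ℤ} (compl : Completion r d p S i c)
                  (u<c : u < c) (c≤t : c ≤ t) where

  private
    valid : ValidPartial r d p S
    valid = sk-valid r d p sk

    edf : EDF r d p S
    edf = sk-edf r d p sk

  busy : ∀ {x} → u ≤ x → x < t → Busy S x
  busy {x} u≤x x<t with S x | proj₁ fs x u≤x x<t
  ... | nothing | Sx≢nothing = ⊥-elim (Sx≢nothing refl)
  ... | just j  | _          = j , refl

  open MaximalSuffix (maximalSuffix (runsJobAtMost? i ∘ S) (ℤP.<⇒≤ u<c)) renaming (start to v)

  v<c : v < c
  v<c with maximal
  ... | inj₁ v≡u       = subst (_< c) (sym v≡u) u<c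
  ... | inj₂ (_ , ¬Q) = ℤP.≤∧≢⇒< start≤w λ v≡c →
          ¬Q (subst (λ y → RunsJobAtMost i (S (y - 1ℤ))) (sym v≡c)
                    (subst (RunsJobAtMost i) (sym (proj₁ compl)) FP.≤-refl))

  suffix-index : ∀ {x j} → v ≤ x → x < c → S x ≡ just j → j Fin.≤ i
  suffix-index {x} v≤x x<c Sx≡j = subst (RunsJobAtMost i) Sx≡j (holds x v≤x x<c)

  suffix-released : ∀ {x j} → v ≤ x → x < c → S x ≡ just j → v ≤ r j
  suffix-released {x} {j} v≤x x<c Sx≡j with maximal
  ... | inj₁ v≡u = subst (_≤ r j) (sym v≡u)
          (proj₁ (proj₂ fs x j (subst (_≤ x) v≡u v≤x) (ℤP.<-≤-trans x<c c≤t) Sx≡j))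
  ... | inj₂ (u<v , ¬Q) with busy (<⇒≤-1 u<v) (ℤP.<-trans (i-1<i v) (ℤP.<-≤-trans v<c c≤t))
  ...   | (h , Sv-1≡h) = ℤP.≮⇒≥ λ rj<v → ¬Q (subst (RunsJobAtMost i) (sym Sv-1≡h)
            (FP.≤-trans (edf-index≤ r d p increasing edf Sv-1≡h Sx≡j
                           (ℤP.<⇒≤ (ℤP.<-≤-trans (i-1<i v) v≤x)) (<⇒≤-1 rj<v))
                        (suffix-index v≤x x<c Sx≡j)))

  module Competitor {k′ : Fin n} (i≤k′ : i Fin.≤ k′) {S′ : Schedule n} {m′ : ℤ}
                    (sk′ : SKSchedule r d p s k′ S′ m′) {c′ : ℤ} (compl′ : Completion r d p S′ i c′)
                    (c′<c : c′ < c) where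

    v≤ri : v ≤ r i
    v≤ri = suffix-released (<⇒≤-1 v<c) (i-1<i c) (proj₁ compl)

    ri<c′ : r i < c′
    ri<c′ = ≤-1⇒< (proj₁ (slot-in-window r d p (sk-valid r d p sk′) (proj₁ compl′)))

    v≤c′ : v ≤ c′
    v≤c′ = ℤP.<⇒≤ (ℤP.≤-<-trans v≤ri ri<c′)

    rs≤v : r s ≤ v
    rs≤v with busy u≤start (ℤP.<-≤-trans v<c c≤t)
    ... | (g , Sv≡g) = ℤP.≤-trans (sk-released r d p sk (v , Sv≡g)) (proj₁ (slot-in-window r d p valid Sv≡g))

    P : Fin n → Set
    P j = (j Fin.≤ i) × (v ≤ r j) × (r j < c′)

    P? : Decidable P
    P? j = (j Fin.≤? i) ×-dec (v ℤ.≤? r j) ×-dec (r j ℤ.<? c′)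

    slots-in-S : ∀ {j} → P j → ∀ x → S x ≡ just j → (v ≤ x) × (x < c)
    slots-in-S (j≤i , v≤rj , rj<c′) x Sx≡j =
      ℤP.≤-trans v≤rj (proj₁ (slot-in-window r d p valid Sx≡j)) ,
      edf-completes-before r d p increasing edf compl j≤i (ℤP.<-trans rj<c′ c′<c) Sx≡j

    slots-in-S′ : ∀ {j} → P j → ∀ x → S′ x ≡ just j → (v ≤ x) × (x < c′)
    slots-in-S′ (j≤i , v≤rj , rj<c′) x S′x≡j =
      ℤP.≤-trans v≤rj (proj₁ (slot-in-window r d p (sk-valid r d p sk′) S′x≡j)) ,
      edf-completes-before r d p increasing (sk-edf r d p sk′) compl′ j≤i rj<c′ S′x≡j

    L L′ : ℕ
    L  = ∣ c - v ∣
    L′ = ∣ c′ - v ∣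

    scheduled-in-S : ∀ {j} → P j → Scheduled r d p S j
    scheduled-in-S (j≤i , v≤rj , rj<c′) = sk-complete r d p sk (FP.≤-trans j≤i i≤k)
      (ℤP.≤-trans rs≤v v≤rj) (ℤP.<-trans rj<c′ (ℤP.<-≤-trans c′<c c≤t))

    scheduled-in-S′ : ∀ {j} → P j → Scheduled r d p S′ j
    scheduled-in-S′ (j≤i , v≤rj , rj<c′) = sk-complete r d p sk′ (FP.≤-trans j≤i i≤k′)
      (ℤP.≤-trans rs≤v v≤rj) (ℤP.<-≤-trans rj<c′ (sk-completion≤Cmax r d p sk′ compl′))

    count-in-S : ∀ {j} → P j → countFrom S j v L ≡ p j
    count-in-S Pj = countFrom≡processingTime r d p valid (scheduled-in-S Pj) (ℤP.<⇒≤ v<c) (slots-in-S Pj)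

    count-in-S′ : ∀ {j} → P j → countFrom S′ j v L′ ≡ p j
    count-in-S′ Pj = countFrom≡processingTime r d p (sk-valid r d p sk′) (scheduled-in-S′ Pj) v≤c′ (slots-in-S′ Pj)

    counts-agree : ∀ j → countFrom (restrict P? S) j v L ≡ countFrom (restrict P? S′) j v L′
    counts-agree j with P? j
    ... | no ¬Pj = trans (countFrom-restrict-¬ P? S ¬Pj v L) (sym (countFrom-restrict-¬ P? S′ ¬Pj v L′))
    ... | yes Pj = begin
      countFrom (restrict P? S) j v L   ≡⟨ countFrom-restrict P? S Pj v L ⟩
      countFrom S j v L                 ≡⟨ count-in-S Pj ⟩
      p j                               ≡⟨ count-in-S′ Pj ⟨
      countFrom S′ j v L′               ≡⟨ countFrom-restrict P? S′ Pj v L′ ⟨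
      countFrom (restrict P? S′) j v L′ ∎
      where open ≡-Reasoning

    busyFrom-agree : busyFrom (restrict P? S) v L ≡ busyFrom (restrict P? S′) v L′
    busyFrom-agree = begin
      busyFrom (restrict P? S) v L                 ≡⟨ ∑-countFrom≡busyFrom (restrict P? S) v L ⟨
      sum (λ j → countFrom (restrict P? S) j v L)   ≡⟨ sum-cong-≗ counts-agree ⟩
      sum (λ j → countFrom (restrict P? S′) j v L′) ≡⟨ ∑-countFrom≡busyFrom (restrict P? S′) v L′ ⟩
      busyFrom (restrict P? S′) v L′               ∎
      where open ≡-Reasoning

    v+L≡c : v + + L ≡ c
    v+L≡c = i+∣j-i∣≡j (ℤP.<⇒≤ v<c)

    v+L′≡c′ : v + + L′ ≡ c′
    v+L′≡c′ = i+∣j-i∣≡j v≤c′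

    busy-in-S : suc L′ ℕ.≤ busyFrom (restrict P? S) v L
    busy-in-S = busyFrom-lowerBound (restrict P? S) v L′ L
      (+-cancelˡ-<⁺ v L′ L (subst₂ _<_ (sym v+L′≡c′) (sym v+L≡c) c′<c))
      before-c′ (c - 1ℤ)
      (subst (_≤ c - 1ℤ) (sym v+L′≡c′) (<⇒≤-1 c′<c)) (subst (c - 1ℤ <_) (sym v+L≡c) (i-1<i c))
      (i , restrict-just P? S (FP.≤-refl , v≤ri , ri<c′) (proj₁ compl))
      where
        before-c′ : ∀ x → v ≤ x → x < v + + L′ → Busy (restrict P? S) x
        before-c′ x v≤x x< = job-in-P (busy (ℤP.≤-trans u≤start v≤x) (ℤP.<-trans x<c′ (ℤP.<-≤-trans c′<c c≤t)))
          where
            x<c′ : x < c′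
            x<c′ = subst (x <_) v+L′≡c′ x<
            x<c : x < c
            x<c = ℤP.<-trans x<c′ c′<c
            job-in-P : Busy S x → Busy (restrict P? S) x
            job-in-P (j , Sx≡j) = j , restrict-just P? S
              (suffix-index v≤x x<c Sx≡j , suffix-released v≤x x<c Sx≡j ,
               ℤP.≤-<-trans (proj₁ (slot-in-window r d p valid Sx≡j)) x<c′) Sx≡j

    impossible : ⊥
    impossible = ℕP.<-irrefl refl (ℕP.<-≤-trans busy-in-S
                   (subst (ℕ._≤ L′) (sym busyFrom-agree) (busyFrom≤length (restrict P? S′) v L′)))

  completion-minimal : ∀ {k′} → i Fin.≤ k′ → ∀ {S′ m′} → SKSchedule r d p s k′ S′ m′ →
                       ∀ {c′} → Completion r d p S′ i c′ → c ≤ c′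
  completion-minimal i≤k′ sk′ compl′ = ℤP.≮⇒≥ (Competitor.impossible i≤k′ sk′ compl′)

lemma2 : {n : ℕ} (r d : Fin n → ℤ) (p : Fin n → ℕ) →
    StandingAssumptions r d p →
    (s k : Fin n) (S : Schedule n) (t u : ℤ) →
    SKSchedule r d p s k S t →
    FixedSegment r d p S u t →
    (i : Fin n) → i Fin.≤ k →
    (c : ℤ) → Completion r d p S i c →
    u ℤ.< c → c ℤ.≤ t →
    OptCompletion r d p s i c
lemma2 r d p (_ , increasing , _) s k S t u sk fs i i≤k c compl u<c c≤t =
  (k , i≤k , S , t , sk , compl) ,
  λ k′ i≤k′ S′ m′ sk′ c′ compl′ → completion-minimal i≤k′ sk′ compl′
  where open Optimality increasing sk fs i≤k compl u<c c≤t
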